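{- Let $k\geq 0$, let $\Sigma_k=\{a_0,\dots,a_{k-1}\}$ and $\Sigma_{k\#}=\Sigma_k\uplus\{\#\}$. The map $\pi$ restricted to the set $\mathsf{p}(\Sigma_{k\#}^\ast)$ of pure codes is a bijection from $\mathsf{p}(\Sigma_{k\#}^\ast)$ onto the set of ordinals $\Omega_k=\omega^{\omega^k}$ (i.e. onto all ordinals $\alpha<\omega^{\omega^k}$).
   Context: Let $\varphi(a_i)=i$. For a word $w=b_1\cdots b_n\in\Sigma_k^\ast$ define the ordinal $\beta(w)=\omega^{\varphi(b_1)}+\cdots+\omega^{\varphi(b_n)}$ (ordinal addition; $\beta(\varepsilon)=0$). A word $b_1\cdots b_n$ over $\Sigma_k$ is pure if $\varphi(b_j)\geq\varphi(b_{j+1})$ for all $1\leq j<n$. A code is a word $x\in\Sigma_{k\#}^\ast$, written uniquely as $x=w_1\#w_2\#\cdots\#w_p\#w_{p+1}$ with $w_i\in\Sigma_k^\ast$; its ordinal is defined inductively by $\pi(w)=0$ and $\pi(w\#x)=\omega^{\beta(w)}\cdot\pi(x)+\omega^{\beta(w)}$ for $w\in\Sigma_k^\ast$ and $x$ a code (equivalently $\pi(x)=\omega^{\beta(w_1\cdots w_p)}+\cdots+\omega^{\beta(w_1w_2)}+\omega^{\beta(w_1)}$). A code $x=w_1\#\cdots\#w_p\#w_{p+1}$ is pure if $w_{p+1}=\varepsilon$ and each $w_i$ ($1\leq i\leq p$) is a pure word (the concatenation $w_iw_{i+1}$ need not be pure). $\mathsf{p}(\Sigma_{k\#}^\ast)$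 denotes the set of pure codes. -}

module Defs where

open import Data.Nat using (ℕ; zero; suc; _≤_)
open import Data.Fin using (Fin; toℕ)
open import Data.List using (List; []; _∷_; _∷ʳ_)
open import Data.Maybe using (Maybe; just; nothing)
open import Data.Product using (_×_)
open import Data.Sum using (_⊎_)
open import Data.Unit using (⊤)
open import Data.List.Relation.Unary.Linked using (Linked)
open import Relation.Binary.PropositionalEquality using (_≡_)

-- Ordinals below ε₀, in (hereditary) Cantor normal form.
--   ω^ a + b  denotes  ω^a + b  (ordinal addition).
-- An ordinal is a term that is in normal form (predicate NF below);
-- on normal forms, syntactic equality is ordinal equality and `cmp`
-- is the ordinal order.

data Ord : Set where
  𝟎     : Ord
  ω^_+_ : Ord → Ord → Ord

data Cmp : Set where
  lt eq gt : Cmp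

cmp : Ord → Ord → Cmp
cmp 𝟎 𝟎 = eq
cmp 𝟎 (ω^ _ + _) = lt
cmp (ω^ _ + _) 𝟎 = gt
cmp (ω^ a + b) (ω^ c + d) with cmp a c
... | lt = lt
... | gt = gt
... | eq = cmp b d

_<ₒ_ : Ord → Ord → Set
α <ₒ β = cmp α β ≡ lt

_≤ₒ_ : Ord → Ord → Set
c ≤ₒ a = (cmp c a ≡ lt) ⊎ (cmp c a ≡ eq)

LeadLe : Ord → Ord → Set
LeadLe a 𝟎 = ⊤
LeadLe a (ω^ c + _) = c ≤ₒ a

NF : Ord → Set
NF 𝟎 = ⊤
NF (ω^ a + b) = NF a × NF b × LeadLe a b

_⊕_ : Ord → Ord → Ord
𝟎 ⊕ β = β
(ω^ a + α) ⊕ 𝟎 = ω^ a + α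
(ω^ a + α) ⊕ (ω^ b + β) with cmp a b
... | lt = ω^ b + β
... | eq = ω^ a + (α ⊕ (ω^ b + β))
... | gt = ω^ a + (α ⊕ (ω^ b + β))

-- α · ω^b
mulω : Ord → Ord → Ord
mulω α 𝟎 = α
mulω 𝟎 (ω^ _ + _) = 𝟎
mulω (ω^ a + _) (ω^ b + b') = ω^ (a ⊕ (ω^ b + b')) + 𝟎

_⊗_ : Ord → Ord → Ord
α ⊗ 𝟎 = 𝟎
α ⊗ (ω^ b + γ) = mulω α b ⊕ (α ⊗ γ)

ωexp : Ord → Ord
ωexp α = ω^ α + 𝟎

nat : ℕ → Ord
nat zero = 𝟎
nat (suc n) = ω^ 𝟎 + nat n

Ω : ℕ → Ord
Ω k = ωexp (ωexp (nat k))

-- Alphabets: Σ_k = Fin k (a_i ↦ i), Σ_{k#} = Maybe (Fin k), nothing = #.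

Σ# : ℕ → Set
Σ# k = Maybe (Fin k)

φ : ∀ {k} → Fin k → ℕ
φ = toℕ

β : ∀ {k} → List (Fin k) → Ord
β [] = 𝟎
β (b ∷ w) = ωexp (nat (φ b)) ⊕ β w

PureWord : ∀ {k} → List (Fin k) → Set
PureWord = Linked (λ a b → φ b ≤ φ a)

-- π with accumulator w = the current (not yet #-terminated) prefix word:
--   πacc w x = π(w x)
πacc : ∀ {k} → List (Fin k) → List (Σ# k) → Ord
πacc w [] = 𝟎
πacc w (just a ∷ x) = πacc (w ∷ʳ a) x
πacc w (nothing ∷ x) = (ωexp (β w) ⊗ πacc [] x) ⊕ ωexp (β w)

π : ∀ {k} → List (Σ# k) → Ord
π = πacc []

-- pure code: every #-terminated block is a pure word, final block empty
PureAcc : ∀ {k} → List (Fin k) → List (Σ# k) → Set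
PureAcc w [] = w ≡ []
PureAcc w (just a ∷ x) = PureAcc (w ∷ʳ a) x
PureAcc w (nothing ∷ x) = PureWord w × PureAcc [] x

PureCode : ∀ {k} → List (Σ# k) → Set
PureCode = PureAcc []

module Submission where

-- A pure word a_{i₁}⋯a_{iₙ} (i₁ ≥ ⋯ ≥ iₙ) denotes the Cantor normal form
-- ⟦x⟧ = ω^{i₁}+⋯+ω^{iₙ}, and these are exactly the normal forms below ω^k (word-of).  The
-- lexicographic order of words is the ordinal order, and ordinal addition of words is ⊞,
-- which absorbs the letters of d smaller than the head of e.  Left addition d ⊞ _ is an
-- order embedding (hence cancellative) and can be inverted on pure words above d.
--
-- Lists of words.  A non-increasing list X of pure words denotes the normal form
-- Ev X = Σ ω^⟦x⟧, and every normal form below Ω_k is Ev X for exactly one such X (cnf).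
--
-- The code w₁#⋯#wₚ# has ordinal π = ω^(w₁⋯wₚ) + ⋯ + ω^(w₁w₂) + ω^(w₁), i.e.
-- π ∘ encode = Ev ∘ sums where sums lists the cumulative ⊞-sums (π-encode).  The map sums
-- is injective and maps lists of pure words onto sorted lists of pure words.  Since every
-- pure code is encode ws for a list ws of pure words (decode), the theorem follows.

open import Defs
open import Data.Nat using (ℕ; zero; suc; _≤_; _<_; z≤n; s≤s; _<?_)
open import Data.Nat.Properties using (m≤n⇒m<n∨m≡n; <-irrefl; <-cmp; ≤-<-trans; <⇒≤; <⇒≱; ≤-refl; ≤-trans; ≮⇒≥; suc-injective; +-comm)
open import Data.Fin using (Fin; toℕ; fromℕ<) renaming (_<_ to _<ᶠ_)
open import Data.Fin.Properties using (toℕ-injective; toℕ<n; toℕ-fromℕ<)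
open import Data.Fin.Properties as Fin using ()
open import Data.List using (List; []; _∷_; _∷ʳ_; _++_; map; length; [_]; initLast; _∷ʳ′_)
open import Data.List.Properties using (∷ʳ-injective; map-injective; length-map; length-++; ++-identityʳ; map-++; ∷ʳ-++)
open import Data.List.Relation.Binary.Lex.Core using (base; halt; this; next)
open import Data.List.Relation.Binary.Lex.Strict using (Lex-≤; ≤-reflexive; ≤-antisymmetric; ≤-transitive)
open import Data.List.Relation.Binary.Pointwise using (Pointwise-≡⇒≡; ≡⇒Pointwise-≡)
open import Data.List.Relation.Unary.Linked using ([]; [-]; _∷_; tail)
open import Data.List.Relation.Unary.All as All using (All; []; _∷_)
open import Data.List.Relation.Unary.All.Properties as All using ()
open import Data.List.Relation.Unary.AllPairs as AllPairs using (AllPairs; []; _∷_)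
open import Data.List.Relation.Unary.AllPairs.Properties as AllPairs using ()
open import Data.Maybe using (just; nothing)
open import Data.Product using (_×_; _,_; Σ-syntax)
open import Data.Sum using (inj₁; inj₂)
open import Data.Unit using (⊤; tt)
open import Relation.Binary.Definitions using (tri<; tri≈; tri>)
open import Relation.Binary.Structures using (IsStrictTotalOrder)
open import Relation.Nullary using (¬_; yes; no; contradiction)
open import Relation.Binary.PropositionalEquality hiding ([_])

private variable
  k m n : ℕ

flipCmp : Cmp → Cmp
flipCmp lt = gt
flipCmp eq = eq
flipCmp gt = lt

cmp-refl : ∀ a → cmp a a ≡ eq
cmp-refl 𝟎 = refl
cmp-refl (ω^ a + b) rewrite cmp-refl a = cmp-refl b

cmp-flip : ∀ a b → cmp b a ≡ flipCmp (cmp a b)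
cmp-flip 𝟎 𝟎 = refl
cmp-flip 𝟎 (ω^ _ + _) = refl
cmp-flip (ω^ _ + _) 𝟎 = refl
cmp-flip (ω^ a + a') (ω^ b + b') with cmp a b | cmp-flip a b
... | lt | p rewrite p = refl
... | eq | p rewrite p = cmp-flip a' b'
... | gt | p rewrite p = refl

cmp-eq : ∀ a b → cmp a b ≡ eq → a ≡ b
cmp-eq 𝟎 𝟎 _ = refl
cmp-eq (ω^ a + a') (ω^ b + b') h with cmp a b in p
... | eq = cong₂ ω^_+_ (cmp-eq a b p) (cmp-eq a' b' h)

≡⇒≤ₒ : ∀ a b → a ≡ b → a ≤ₒ b
≡⇒≤ₒ a .a refl = inj₂ (cmp-refl a)

head-< : ∀ a a' b b' → a <ₒ b → (ω^ a + a') <ₒ (ω^ b + b')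
head-< a a' b b' a<b rewrite a<b = refl

tail-< : ∀ a a' b' → a' <ₒ b' → (ω^ a + a') <ₒ (ω^ a + b')
tail-< a a' b' a'<b' rewrite cmp-refl a = a'<b'

lead-< : ∀ a a' b → (ω^ a + a') <ₒ ωexp b → a <ₒ b
lead-< a a' b h with cmp a b
... | lt = refl
lead-< a 𝟎 b () | eq
lead-< a (ω^ _ + _) b () | eq

lead-≤ : ∀ a a' b b' → (ω^ a + a') ≤ₒ (ω^ b + b') → a ≤ₒ b
lead-≤ a a' b b' h with cmp a b
... | lt = inj₁ refl
... | eq = inj₂ refl
lead-≤ a a' b b' (inj₁ ()) | gt
lead-≤ a a' b b' (inj₂ ()) | gt

<ₒ-trans : ∀ a b c → a <ₒ b → b <ₒ c → a <ₒ c
<ₒ-trans 𝟎 (ω^ _ + _) (ω^ _ + _) _ _ = refl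
<ₒ-trans (ω^ a + a') (ω^ b + b') (ω^ c + c') h₁ h₂ with cmp a b in p | cmp b c in q
... | lt | lt = head-< a a' c c' (<ₒ-trans a b c p q)
... | lt | eq rewrite cmp-eq b c q = head-< a a' c c' p
... | eq | lt rewrite cmp-eq a b p = head-< b a' c c' q
... | eq | eq rewrite cmp-eq a b p | cmp-eq b c q = tail-< c a' c' (<ₒ-trans a' b' c' h₁ h₂)

≤<-trans : ∀ a b c → a ≤ₒ b → b <ₒ c → a <ₒ c
≤<-trans a b c (inj₁ a<b) b<c = <ₒ-trans a b c a<b b<c
≤<-trans a b c (inj₂ a≡b) b<c rewrite cmp-eq a b a≡b = b<c

lead-bound : ∀ e b c → LeadLe b e → b <ₒ c → e <ₒ ωexp c
lead-bound 𝟎 _ _ _ _ = refl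
lead-bound (ω^ a + e) b c a≤b b<c = head-< a e c 𝟎 (≤<-trans a b c a≤b b<c)

⊕-≥ : ∀ a α b β' → b ≤ₒ a → (ω^ a + α) ⊕ (ω^ b + β') ≡ ω^ a + (α ⊕ (ω^ b + β'))
⊕-≥ a α b β' b≤a with cmp a b | cmp-flip a b
... | eq | _ = refl
... | gt | _ = refl
⊕-≥ a α b β' (inj₁ b<a) | lt | p rewrite p with b<a
... | ()
⊕-≥ a α b β' (inj₂ b≡a) | lt | p rewrite p with b≡a
... | ()

ω-cons : ∀ a β' → LeadLe a β' → ωexp a ⊕ β' ≡ ω^ a + β'
ω-cons a 𝟎 _ = refl
ω-cons a (ω^ b + β') b≤a = ⊕-≥ a 𝟎 b β' b≤a

nat-< : m < n → nat m <ₒ nat n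
nat-< {zero} {suc n} _ = refl
nat-< {suc m} {suc n} (s≤s m<n) = nat-< m<n

nat-≤ : m ≤ n → nat m ≤ₒ nat n
nat-≤ {m} m≤n with m≤n⇒m<n∨m≡n m≤n
... | inj₁ m<n = inj₁ (nat-< m<n)
... | inj₂ refl = inj₂ (cmp-refl (nat m))

nat-≤⁻ : nat m ≤ₒ nat n → m ≤ n
nat-≤⁻ {zero} _ = z≤n
nat-≤⁻ {suc m} {zero} (inj₁ ())
nat-≤⁻ {suc m} {zero} (inj₂ ())
nat-≤⁻ {suc m} {suc n} h = s≤s (nat-≤⁻ h)

nat-NF : ∀ n → NF (nat n)
nat-NF zero = tt
nat-NF (suc zero) = tt , tt , tt
nat-NF (suc (suc n)) = tt , nat-NF (suc n) , inj₂ refl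

below-nat : ∀ c n → c <ₒ nat n → Σ[ m ∈ ℕ ] (m < n × c ≡ nat m)
below-nat 𝟎 (suc n) _ = zero , s≤s z≤n , refl
below-nat (ω^ 𝟎 + c) (suc n) h with below-nat c n h
... | m , m<n , refl = suc m , s≤s m<n , refl
below-nat (ω^ (ω^ _ + _) + _) (suc _) ()

Word : ℕ → Set
Word k = List (Fin k)

private variable
  a c : Fin k
  d e f w x : Word k
  X Y ws : List (Word k)

⟦_⟧ : Word k → Ord
⟦ [] ⟧ = 𝟎
⟦ a ∷ d ⟧ = ω^ nat (toℕ a) + ⟦ d ⟧

HeadBelow : ℕ → Word k → Set
HeadBelow n [] = ⊤
HeadBelow n (c ∷ _) = toℕ c ≤ n

pure-∷ : HeadBelow (toℕ a) x → PureWord x → PureWord (a ∷ x)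
pure-∷ {x = []} _ _ = [-]
pure-∷ {x = _ ∷ _} h p = h ∷ p

pure-head : PureWord (a ∷ x) → HeadBelow (toℕ a) x
pure-head [-] = tt
pure-head (h ∷ _) = h

head-lead : HeadBelow n x → LeadLe (nat n) ⟦ x ⟧
head-lead {x = []} _ = tt
head-lead {x = _ ∷ _} h = nat-≤ h

lead-head : LeadLe (nat n) ⟦ x ⟧ → HeadBelow n x
lead-head {x = []} _ = tt
lead-head {x = _ ∷ _} h = nat-≤⁻ h

pure-NF : PureWord x → NF ⟦ x ⟧
pure-NF {x = []} _ = tt
pure-NF {x = a ∷ x} p = nat-NF (toℕ a) , pure-NF (tail p) , head-lead (pure-head p)

β-pure : PureWord x → β x ≡ ⟦ x ⟧
β-pure {x = []} _ = refl
β-pure {x = a ∷ x} p rewrite β-pure (tail p) =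
  ω-cons (nat (toℕ a)) ⟦ x ⟧ (head-lead (pure-head p))

word-bound : ∀ (x : Word k) → ⟦ x ⟧ <ₒ ωexp (nat k)
word-bound [] = refl
word-bound {k} (a ∷ x) = head-< (nat (toℕ a)) ⟦ x ⟧ (nat k) 𝟎 (nat-< (toℕ<n a))

word-of : ∀ e → NF e → e <ₒ ωexp (nat k) → Σ[ x ∈ Word k ] (⟦ x ⟧ ≡ e × PureWord x)
word-of 𝟎 _ _ = [] , refl , []
word-of {k} (ω^ a + e) (_ , nfe , e≤a) h with below-nat a k (lead-< a e (nat k) h)
... | m , m<k , refl with word-of e nfe (lead-bound e (nat m) (nat k) e≤a (nat-< m<k))
... | x , refl , px =
  fromℕ< m<k ∷ x ,
  cong (λ i → ω^ nat i + ⟦ x ⟧) (toℕ-fromℕ< m<k) ,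
  pure-∷ (subst (λ i → HeadBelow i x) (sym (toℕ-fromℕ< m<k)) (lead-head e≤a)) px

infix 4 _≤L_
_≤L_ : Word k → Word k → Set
_≤L_ = Lex-≤ _≡_ _<ᶠ_

module _ {k : ℕ} where
  open IsStrictTotalOrder (Fin.<-isStrictTotalOrder {k})
    using (<-resp-≈; irrefl; asym) renaming (trans to <ᶠ-trans)

  ≤L-refl : (x : Word k) → x ≤L x
  ≤L-refl x = ≤-reflexive _≡_ _<ᶠ_ (≡⇒Pointwise-≡ refl)

  ≤L-trans : {x y z : Word k} → x ≤L y → y ≤L z → x ≤L z
  ≤L-trans = ≤-transitive isEquivalence <-resp-≈ <ᶠ-trans

  ≤L-antisym : {x y : Word k} → x ≤L y → y ≤L x → x ≡ y
  ≤L-antisym p q = Pointwise-≡⇒≡ (≤-antisymmetric sym irrefl asym p q)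

[]≤L : (x : Word k) → [] ≤L x
[]≤L [] = base tt
[]≤L (_ ∷ _) = halt

≤L-head : (a ∷ d) ≤L (c ∷ e) → toℕ a ≤ toℕ c
≤L-head (this a<c) = <⇒≤ a<c
≤L-head (next refl _) = ≤-refl

≤L-tail : (a ∷ d) ≤L (a ∷ e) → d ≤L e
≤L-tail (this a<a) = contradiction a<a (<-irrefl refl)
≤L-tail (next _ d≤e) = d≤e

≤L-sound : d ≤L e → ⟦ d ⟧ ≤ₒ ⟦ e ⟧
≤L-sound (base _) = inj₂ refl
≤L-sound halt = inj₁ refl
≤L-sound (this a<c) rewrite nat-< a<c = inj₁ refl
≤L-sound (next {x = a} refl d≤e) rewrite cmp-refl (nat (toℕ a)) = ≤L-sound d≤e

≤L-complete : (d e : Word k) → ⟦ d ⟧ ≤ₒ ⟦ e ⟧ → d ≤L e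
≤L-complete [] e _ = []≤L e
≤L-complete (a ∷ d) [] (inj₁ ())
≤L-complete (a ∷ d) [] (inj₂ ())
≤L-complete (a ∷ d) (c ∷ e) h with <-cmp (toℕ a) (toℕ c)
... | tri< a<c _ _ = this a<c
... | tri> _ _ c<a =
  contradiction (nat-≤⁻ (lead-≤ (nat (toℕ a)) ⟦ d ⟧ (nat (toℕ c)) ⟦ e ⟧ h)) (<⇒≱ c<a)
... | tri≈ _ a≡c _ with toℕ-injective a≡c
... | refl rewrite cmp-refl (nat (toℕ a)) = next refl (≤L-complete d e h)

⟦⟧-injective : (d e : Word k) → ⟦ d ⟧ ≡ ⟦ e ⟧ → d ≡ e
⟦⟧-injective d e h =
  ≤L-antisym (≤L-complete d e (≡⇒≤ₒ _ _ h)) (≤L-complete e d (≡⇒≤ₒ _ _ (sym h)))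

-- Ordinal addition of words: the letters of d smaller than the head of e are absorbed.
infixl 6 _⊞_
_⊞_ : Word k → Word k → Word k
[] ⊞ e = e
(a ∷ d) ⊞ [] = a ∷ d
(a ∷ d) ⊞ (c ∷ e) with toℕ a <? toℕ c
... | yes _ = c ∷ e
... | no _ = a ∷ (d ⊞ (c ∷ e))

⊞-absorb : toℕ a < toℕ c → (a ∷ d) ⊞ (c ∷ e) ≡ c ∷ e
⊞-absorb {a = a} {c = c} a<c with toℕ a <? toℕ c
... | yes _ = refl
... | no a≮c = contradiction a<c a≮c

⊞-keep : toℕ c ≤ toℕ a → (a ∷ d) ⊞ (c ∷ e) ≡ a ∷ (d ⊞ (c ∷ e))
⊞-keep {c = c} {a = a} c≤a with toℕ a <? toℕ c
... | yes a<c = contradiction c≤a (<⇒≱ a<c)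
... | no _ = refl

⊞-identityʳ : (d : Word k) → d ⊞ [] ≡ d
⊞-identityʳ [] = refl
⊞-identityʳ (_ ∷ _) = refl

⟦⊞⟧ : (d e : Word k) → ⟦ d ⟧ ⊕ ⟦ e ⟧ ≡ ⟦ d ⊞ e ⟧
⟦⊞⟧ [] e = refl
⟦⊞⟧ (a ∷ d) [] = refl
⟦⊞⟧ (a ∷ d) (c ∷ e) with toℕ a <? toℕ c
... | yes a<c rewrite nat-< a<c = refl
... | no a≮c =
  trans (⊕-≥ (nat (toℕ a)) ⟦ d ⟧ (nat (toℕ c)) ⟦ e ⟧ (nat-≤ (≮⇒≥ a≮c)))
        (cong (ω^ nat (toℕ a) +_) (⟦⊞⟧ d (c ∷ e)))

-- Sums of pure words are pure: the head of d ⊞ e is a head of d or of e.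
⊞-head : HeadBelow n d → HeadBelow n e → HeadBelow n (d ⊞ e)
⊞-head {d = []} _ he = he
⊞-head {d = a ∷ d} {e = []} hd _ = hd
⊞-head {d = a ∷ d} {e = c ∷ e} hd he with toℕ a <? toℕ c
... | yes _ = he
... | no _ = hd

-- The head of e survives in d ⊞ e, so it is bounded by the head of the sum.
⊞-head⁻ : HeadBelow n (d ⊞ (c ∷ e)) → toℕ c ≤ n
⊞-head⁻ {d = []} h = h
⊞-head⁻ {d = a ∷ d} {c = c} h with toℕ a <? toℕ c
... | yes _ = h
... | no a≮c = ≤-trans (≮⇒≥ a≮c) h

⊞-pure : PureWord d → PureWord e → PureWord (d ⊞ e)
⊞-pure {d = []} _ pe = pe
⊞-pure {d = a ∷ d} {e = []} pd _ = pd
⊞-pure {d = a ∷ d} {e = c ∷ e} pd pe with toℕ a <? toℕ c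
... | yes _ = pe
... | no a≮c = pure-∷ (⊞-head (pure-head pd) (≮⇒≥ a≮c)) (⊞-pure (tail pd) pe)

⊞-increasing : (d e : Word k) → d ≤L d ⊞ e
⊞-increasing [] e = []≤L e
⊞-increasing (a ∷ d) [] = ≤L-refl (a ∷ d)
⊞-increasing (a ∷ d) (c ∷ e) with toℕ a <? toℕ c
... | yes a<c = this a<c
... | no _ = next refl (⊞-increasing d (c ∷ e))

⊞-not-below : ¬ (d ⊞ (c ∷ e) ≤L d)
⊞-not-below {d = a ∷ d} {c = c} h with toℕ a <? toℕ c
... | yes a<c = contradiction (≤L-head h) (<⇒≱ a<c)
... | no _ = ⊞-not-below (≤L-tail h)

⊞-mono : (d : Word k) → e ≤L f → d ⊞ e ≤L d ⊞ f
⊞-mono [] e≤f = e≤f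
⊞-mono {e = []} {f = f} (a ∷ d) _ = ⊞-increasing (a ∷ d) f
⊞-mono {e = c ∷ e} {f = c' ∷ f} (a ∷ d) e≤f with toℕ a <? toℕ c | toℕ a <? toℕ c'
... | yes _ | yes _ = e≤f
... | yes a<c | no a≮c' = contradiction (≤-trans (≤L-head e≤f) (≮⇒≥ a≮c')) (<⇒≱ a<c)
... | no _ | yes a<c' = this a<c'
... | no _ | no _ = next refl (⊞-mono d e≤f)

⊞-reflect : (d : Word k) → d ⊞ e ≤L d ⊞ f → e ≤L f
⊞-reflect [] h = h
⊞-reflect {e = []} {f = f} (a ∷ d) _ = []≤L f
⊞-reflect {e = c ∷ e} {f = []} (a ∷ d) h with toℕ a <? toℕ c
... | yes a<c = contradiction (≤L-head h) (<⇒≱ a<c)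
... | no _ = contradiction (≤L-tail h) ⊞-not-below
⊞-reflect {e = c ∷ e} {f = c' ∷ f} (a ∷ d) h with toℕ a <? toℕ c | toℕ a <? toℕ c'
... | yes _ | yes _ = h
... | yes a<c | no _ = contradiction (≤L-head h) (<⇒≱ a<c)
... | no a≮c | yes a<c' = this (≤-<-trans (≮⇒≥ a≮c) a<c')
... | no _ | no _ = ⊞-reflect d (≤L-tail h)

⊞-cancelˡ : (d : Word k) → d ⊞ e ≡ d ⊞ f → e ≡ f
⊞-cancelˡ {e = e} {f = f} d h =
  ≤L-antisym (⊞-reflect d (subst (d ⊞ e ≤L_) h (≤L-refl _)))
             (⊞-reflect d (subst (_≤L d ⊞ e) h (≤L-refl _)))

⊞-subtract : d ≤L f → PureWord f → Σ[ e ∈ Word k ] (d ⊞ e ≡ f × PureWord e)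
⊞-subtract {d = []} {f = f} _ pf = f , refl , pf
⊞-subtract {d = a ∷ d} {f = c ∷ f} (this a<c) pf = c ∷ f , ⊞-absorb a<c , pf
⊞-subtract {d = a ∷ d} {f = a ∷ f} (next refl d≤f) pf with ⊞-subtract d≤f (tail pf)
... | [] , d≡f , _ = [] , cong (a ∷_) (trans (sym (⊞-identityʳ d)) d≡f) , []
... | c ∷ e , refl , pe =
  c ∷ e , ⊞-keep (⊞-head⁻ {d = d} (pure-head pf)) , pe

∷ʳ≢[] : {A : Set} (X : List A) {x : A} → X ∷ʳ x ≢ []
∷ʳ≢[] [] ()
∷ʳ≢[] (_ ∷ _) ()

length-∷ʳ : {A : Set} (X : List A) {x : A} → length (X ∷ʳ x) ≡ suc (length X)
length-∷ʳ X = trans (length-++ X) (+-comm (length X) 1)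

length-map-∷ʳ : {A B : Set} (g : A → B) (X : List A) {y : B} →
                length (map g X ∷ʳ y) ≡ suc n → length X ≡ n
length-map-∷ʳ g X len =
  trans (sym (length-map g X)) (suc-injective (trans (sym (length-∷ʳ (map g X))) len))

Sorted : List (Word k) → Set
Sorted = AllPairs (λ x y → y ≤L x)

Ev : List (Word k) → Ord
Ev [] = 𝟎
Ev (x ∷ X) = ω^ ⟦ x ⟧ + Ev X

Ev-lead : All (_≤L x) X → LeadLe ⟦ x ⟧ (Ev X)
Ev-lead [] = tt
Ev-lead (y≤x ∷ _) = ≤L-sound y≤x

Ev-NF : Sorted X → All PureWord X → NF (Ev X)
Ev-NF [] [] = tt
Ev-NF (X≤x ∷ sX) (px ∷ pX) = pure-NF px , Ev-NF sX pX , Ev-lead X≤x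

Ev-bound : (X : List (Word k)) → Ev X <ₒ Ω k
Ev-bound [] = refl
Ev-bound {k} (x ∷ X) = head-< ⟦ x ⟧ (Ev X) (ωexp (nat k)) 𝟎 (word-bound x)

ω^+-injective : ∀ {a b c d} → ω^ a + b ≡ ω^ c + d → a ≡ c × b ≡ d
ω^+-injective refl = refl , refl

Ev-injective : (X Y : List (Word k)) → Ev X ≡ Ev Y → X ≡ Y
Ev-injective [] [] _ = refl
Ev-injective (x ∷ X) (y ∷ Y) h with ω^+-injective h
... | x≡y , X≡Y = cong₂ _∷_ (⟦⟧-injective x y x≡y) (Ev-injective X Y X≡Y)

mulω-word : (w x : Word k) → mulω (ωexp ⟦ w ⟧) ⟦ x ⟧ ≡ ωexp ⟦ w ⊞ x ⟧
mulω-word w [] = cong ωexp (cong ⟦_⟧ (sym (⊞-identityʳ w)))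
mulω-word w (c ∷ x) = cong ωexp (⟦⊞⟧ w (c ∷ x))

sorted-⊞ : (w : Word k) → Sorted X → Sorted (map (w ⊞_) X)
sorted-⊞ w sX = AllPairs.map⁺ (AllPairs.map (⊞-mono w) sX)

Ev-scale : (w : Word k) → Sorted X → ωexp ⟦ w ⟧ ⊗ Ev X ≡ Ev (map (w ⊞_) X)
Ev-scale w [] = refl
Ev-scale {X = x ∷ X} w (X≤x ∷ sX) = begin
  mulω (ωexp ⟦ w ⟧) ⟦ x ⟧ ⊕ (ωexp ⟦ w ⟧ ⊗ Ev X)
    ≡⟨ cong₂ _⊕_ (mulω-word w x) (Ev-scale w sX) ⟩
  ωexp ⟦ w ⊞ x ⟧ ⊕ Ev (map (w ⊞_) X)
    ≡⟨ ω-cons ⟦ w ⊞ x ⟧ _ (Ev-lead (All.map⁺ (All.map (⊞-mono w) X≤x))) ⟩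
  ω^ ⟦ w ⊞ x ⟧ + Ev (map (w ⊞_) X) ∎
  where open ≡-Reasoning

Ev-snoc : (w : Word k) → All (w ≤L_) X → Ev X ⊕ ωexp ⟦ w ⟧ ≡ Ev (X ∷ʳ w)
Ev-snoc w [] = refl
Ev-snoc {X = x ∷ X} w (w≤x ∷ w≤X) =
  trans (⊕-≥ ⟦ x ⟧ (Ev X) ⟦ w ⟧ 𝟎 (≤L-sound w≤x)) (cong (ω^ ⟦ x ⟧ +_) (Ev-snoc w w≤X))

-- The cumulative sums of w₁,…,wₚ, largest first: w₁⊞⋯⊞wₚ, …, w₁⊞w₂, w₁.
sums : List (Word k) → List (Word k)
sums [] = []
sums (w ∷ ws) = map (w ⊞_) (sums ws) ∷ʳ w

-- Every cumulative sum after the first summand w is ≥ w, so the sums are sorted.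
⊞-increasing-all : (w : Word k) (X : List (Word k)) → All (w ≤L_) (map (w ⊞_) X)
⊞-increasing-all w X = All.map⁺ (All.universal (⊞-increasing w) X)

sums-sorted : (ws : List (Word k)) → Sorted (sums ws)
sums-sorted [] = []
sums-sorted (w ∷ ws) =
  AllPairs.++⁺ (sorted-⊞ w (sums-sorted ws)) ([] ∷ [])
               (All.map (_∷ []) (⊞-increasing-all w (sums ws)))

sums-pure : All PureWord ws → All PureWord (sums ws)
sums-pure [] = []
sums-pure (pw ∷ pws) = All.∷ʳ⁺ (All.map⁺ (All.map (⊞-pure pw) (sums-pure pws))) pw

sums-injective : (ws vs : List (Word k)) → sums ws ≡ sums vs → ws ≡ vs
sums-injective [] [] _ = refl
sums-injective [] (v ∷ vs) h = contradiction (sym h) (∷ʳ≢[] _)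
sums-injective (w ∷ ws) [] h = contradiction h (∷ʳ≢[] _)
sums-injective (w ∷ ws) (v ∷ vs) h with ∷ʳ-injective _ _ h
... | H , refl = cong (w ∷_) (sums-injective ws vs (map-injective (⊞-cancelˡ w) H))

sorted-∷ʳ⁻ : Sorted (Y ∷ʳ w) → Sorted Y × All (w ≤L_) Y
sorted-∷ʳ⁻ {Y = []} _ = [] , []
sorted-∷ʳ⁻ {Y = y ∷ Y} (Yw≤y ∷ sYw) with sorted-∷ʳ⁻ sYw | All.∷ʳ⁻ Yw≤y
... | sY , w≤Y | Y≤y , w≤y = (Y≤y ∷ sY) , (w≤y ∷ w≤Y)

subtract-all : All (w ≤L_) Y → All PureWord Y → Sorted Y →
               Σ[ H ∈ List (Word k) ] (map (w ⊞_) H ≡ Y × All PureWord H × Sorted H)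
subtract-all [] [] [] = [] , refl , [] , []
subtract-all {w = w} (w≤y ∷ w≤Y) (py ∷ pY) (Y≤y ∷ sY)
  with ⊞-subtract w≤y py | subtract-all w≤Y pY sY
... | h , refl , ph | H , refl , pH , sH =
  h ∷ H , refl , ph ∷ pH , All.map (⊞-reflect w) (All.map⁻ Y≤y) ∷ sH


sums-surjective : (n : ℕ) (X : List (Word k)) → length X ≡ n → Sorted X → All PureWord X →
                  Σ[ ws ∈ List (Word k) ] (sums ws ≡ X × All PureWord ws)
sums-surjective n X len sX pX with initLast X
... | [] = [] , refl , []
sums-surjective zero _ len _ _ | Y ∷ʳ′ w = contradiction (trans (sym (length-∷ʳ Y)) len) λ ()
sums-surjective (suc n) _ len sX pX | Y ∷ʳ′ w
  with sorted-∷ʳ⁻ sX | All.∷ʳ⁻ pX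
... | sY , w≤Y | pY , pw with subtract-all w≤Y pY sY
... | H , refl , pH , sH
  with sums-surjective n H (length-map-∷ʳ (w ⊞_) H len) sH pH
... | ws , refl , pws = w ∷ ws , refl , pw ∷ pws

cnf-below : (x : Word k) (α : Ord) → NF α → LeadLe ⟦ x ⟧ α →
            Σ[ X ∈ List (Word k) ] (Ev X ≡ α × Sorted X × All PureWord X × All (_≤L x) X)
cnf-below x 𝟎 _ _ = [] , refl , [] , [] , []
cnf-below {k} x (ω^ e + α) (nfe , nfα , α≤e) e≤x
  with word-of e nfe (≤<-trans e ⟦ x ⟧ (ωexp (nat k)) e≤x (word-bound x))
... | y , refl , py with cnf-below y α nfα α≤e
... | X , refl , sX , pX , X≤y =
  y ∷ X , refl , X≤y ∷ sX , py ∷ pX , y≤x ∷ All.map (λ z≤y → ≤L-trans z≤y y≤x) X≤y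
  where
  y≤x : y ≤L x
  y≤x = ≤L-complete y x e≤x

cnf : (α : Ord) → NF α → α <ₒ Ω k → Σ[ X ∈ List (Word k) ] (Ev X ≡ α × Sorted X × All PureWord X)
cnf 𝟎 _ _ = [] , refl , [] , []
cnf {k} (ω^ e + α) (nfe , nfα , α≤e) α<Ω with word-of e nfe (lead-< e α (ωexp (nat k)) α<Ω)
... | y , refl , py with cnf-below y α nfα α≤e
... | X , refl , sX , pX , X≤y = y ∷ X , refl , X≤y ∷ sX , py ∷ pX

encode : List (Word k) → List (Σ# k)
encode [] = []
encode (w ∷ ws) = map just w ++ nothing ∷ encode ws

-- πacc and PureAcc read the letters of a block into the pending word one by one,
-- so a whole block can be read at once.
read-block : ∀ {ℓ} {R : Set ℓ} (F : Word k → List (Σ# k) → R) →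
             (∀ v a x → F v (just a ∷ x) ≡ F (v ∷ʳ a) x) →
             ∀ v u x → F v (map just u ++ x) ≡ F (v ++ u) x
read-block F step v [] x = cong (λ v′ → F v′ x) (sym (++-identityʳ v))
read-block F step v (a ∷ u) x = begin
  F v (just a ∷ map just u ++ x) ≡⟨ step v a (map just u ++ x) ⟩
  F (v ∷ʳ a) (map just u ++ x)  ≡⟨ read-block F step (v ∷ʳ a) u x ⟩
  F (v ∷ʳ a ++ u) x             ≡⟨ cong (λ v′ → F v′ x) (∷ʳ-++ v a u) ⟩
  F (v ++ a ∷ u) x              ∎
  where open ≡-Reasoning

decode : (v : Word k) (x : List (Σ# k)) → PureAcc v x →
         Σ[ ws ∈ List (Word k) ] (map just v ++ x ≡ encode ws × All PureWord ws)
decode [] [] refl = [] , refl , []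
decode v (just a ∷ x) p with decode (v ∷ʳ a) x p
... | ws , v∷ʳa++x≡ , pws = ws , trans shift v∷ʳa++x≡ , pws
  where
  shift : map just v ++ just a ∷ x ≡ map just (v ∷ʳ a) ++ x
  shift = trans (sym (∷ʳ-++ (map just v) (just a) x)) (cong (_++ x) (sym (map-++ just v [ a ])))
decode v (nothing ∷ x) (pv , px) with decode [] x px
... | ws , refl , pws = v ∷ ws , refl , pv ∷ pws

pure-encode : All PureWord ws → PureCode (encode ws)
pure-encode [] = refl
pure-encode {ws = w ∷ ws} (pw ∷ pws) =
  subst (λ P → P) (sym (read-block PureAcc (λ _ _ _ → refl) [] w (nothing ∷ encode ws)))
        (pw , pure-encode pws)

π-encode : All PureWord ws → π (encode ws) ≡ Ev (sums ws)
π-encode [] = refl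
π-encode {ws = w ∷ ws} (pw ∷ pws) = begin
  π (encode (w ∷ ws))
    ≡⟨ read-block πacc (λ _ _ _ → refl) [] w (nothing ∷ encode ws) ⟩
  (ωexp (β w) ⊗ π (encode ws)) ⊕ ωexp (β w)
    ≡⟨ cong₂ (λ o p → (ωexp o ⊗ p) ⊕ ωexp o) (β-pure pw) (π-encode pws) ⟩
  (ωexp ⟦ w ⟧ ⊗ Ev (sums ws)) ⊕ ωexp ⟦ w ⟧
    ≡⟨ cong (_⊕ ωexp ⟦ w ⟧) (Ev-scale w (sums-sorted ws)) ⟩
  Ev (map (w ⊞_) (sums ws)) ⊕ ωexp ⟦ w ⟧
    ≡⟨ Ev-snoc w (⊞-increasing-all w (sums ws)) ⟩
  Ev (sums (w ∷ ws)) ∎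
  where open ≡-Reasoning

lemma1 : (k : ℕ) →
    ((x : List (Σ# k)) → PureCode x → NF (π x) × (π x <ₒ Ω k))
    × ((x y : List (Σ# k)) → PureCode x → PureCode y → π x ≡ π y → x ≡ y)
    × ((α : Ord) → NF α → α <ₒ Ω k → Σ[ x ∈ List (Σ# k) ] (PureCode x × π x ≡ α))
lemma1 k = into , injective , surjective
  where
  into : (x : List (Σ# k)) → PureCode x → NF (π x) × (π x <ₒ Ω k)
  into x px with decode [] x px
  ... | ws , refl , pws rewrite π-encode pws =
    Ev-NF (sums-sorted ws) (sums-pure pws) , Ev-bound (sums ws)

  injective : (x y : List (Σ# k)) → PureCode x → PureCode y → π x ≡ π y → x ≡ y
  injective x y px py πx≡πy with decode [] x px | decode [] y py
  ... | ws , refl , pws | vs , refl , pvs =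
    cong encode (sums-injective ws vs (Ev-injective (sums ws) (sums vs)
      (trans (sym (π-encode pws)) (trans πx≡πy (π-encode pvs)))))

  surjective : (α : Ord) → NF α → α <ₒ Ω k → Σ[ x ∈ List (Σ# k) ] (PureCode x × π x ≡ α)
  surjective α nfα α<Ω with cnf α nfα α<Ω
  ... | X , refl , sX , pX with sums-surjective (length X) X refl sX pX
  ... | ws , refl , pws = encode ws , pure-encode pws , π-encode pws
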